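{- Consider the algorithm RBIS described in the context, run with any responses in which at most $H$ are incorrect. Suppose that in some iteration, performed at node $v$, a Move-down operation takes place, and let $ch(v)$ be the child of $v$ to which the search moves. Then either the leaf $L_x$ belongs to the subtree of $T$ rooted at $ch(v)$, or at least one of the responses $\mathtt{main}(v)$ and $\mathtt{check}(v)$ obtained in that iteration is incorrect (if no checkup query was asked in that iteration, the latter means that $\mathtt{main}(v)$ is incorrect).
   Context: Setting: $0<m<M$ and an integer $n\ge1$. Let $\rho=(M/m)^{1/2^n}$, $a_i=m\rho^i$ for $i=0,\dots,2^n$, and $L_i=(a_{i-1},a_i]$ for $i=1,\dots,2^n$. There is an unknown best price $p^*\in[m,M]$; let $x$ be the index with $p^*\in L_x$ (with $x=1$ if $p^*=m$). Let $T$ be a complete binary tree of height $n$ whose leaves from left to right are $L_1,\dots,L_{2^n}$; for an internal node $v$, $l(v),r(v)$ are its children and $q_v$ is the index of the rightmost leaf of the subtree rooted at $l(v)$. The main query of $v$ is "Is $p^*\le a_{q_v}$?" (equivalently "is $x\le q_v$?"). Queries are answered adaptively by an oracle; the answer to a query is correct if it is the true answer, and over the whole run at most $H$ answers are incorrect. Algorithm RBIS (Robust Binary Interval Search) uses $n$ queries in total. It starts with the current node $v$ equal to the root and a counter $mu=0$, and repeats the following iteration: ask the main query of $v$ and store the answer as $\mathtt{main}(v)$ (overwriting any earlier stored answer for $v$); let $anc(v)$ be the nearest proper ancestor $w$ of $v$ whose currently stored $\mathtt{main}(w)$ differs from $\mathtt{main}(v)$, or none if no such ancestor exists; if $anc(v)$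 exists, ask again the main query of $w=anc(v)$ (the checkup query) and call its answer $\mathtt{check}(v)$. Then: if $anc(v)$ does not exist or $\mathtt{check}(v)=\mathtt{main}(anc(v))$, perform a Move-down: move to $l(v)$ if $\mathtt{main}(v)$ is Yes and to $r(v)$ if it is No; otherwise perform a Move-up: move to the parent of $v$ and increase $mu$ by one. The search stops as soon as $n$ queries have been asked (an iteration that cannot ask its needed queries performs no move). Let $u$ be the final node and $mu_{end}$ the final value of $mu$; let $a_u$ be the $(H-mu_{end})$-th ancestor of $u$ (or the root if it does not exist), and let $L_l$ be the leftmost leaf of the subtree rooted at $a_u$. RBIS then uses reservation price $a_{l-1}$, i.e. accepts the first revealed price that is at least $a_{l-1}$ (the last price by default). -}

module Defs where

-- Nodes of the complete binary tree T of height n are encoded as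
-- root-to-node paths stored deepest-bit-first (so the parent of b ∷ v is v,
-- and the proper ancestors of v are the proper suffixes of v).
-- Bit false = go to left child l(v), bit true = go to right child r(v).
-- Leaves L_1 … L_{2^n} are numbered 1-based from left to right.
-- The unknown best price p* is represented by the index x of its interval
-- L_x (1 ≤ x ≤ 2^n); the main query of v, "is p* ≤ a_{q_v}?", is
-- equivalently "is x ≤ q_v?".

open import Data.Nat using (ℕ; zero; suc; _+_; _∸_; _^_; _≤_; _<_; _≤ᵇ_)
open import Data.Bool using (Bool; true; false; if_then_else_; _∧_; not)
open import Data.Bool.Properties renaming (_≟_ to _≟ᴮ_)
open import Data.List using (List; []; _∷_; length; _++_)
open import Data.List.Properties using (≡-dec)
open import Data.Maybe using (Maybe; just; nothing)
open import Data.Product using (_×_; _,_)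
open import Relation.Nullary using (yes; no)
open import Relation.Binary.PropositionalEquality using (_≡_)

Node : Set
Node = List Bool

_≟ₙ_ : (u v : Node) → Relation.Nullary.Dec (u ≡ v)
_≟ₙ_ = ≡-dec _≟ᴮ_

depth : Node → ℕ
depth = length

-- number of leaves strictly to the left of the subtree rooted at v
-- (so the subtree of v consists of leaves lo v + 1 … lo v + 2^(n - depth v))
lo : ℕ → Node → ℕ
lo n [] = 0
lo n (b ∷ bs) = lo n bs + (if b then 2 ^ (n ∸ suc (length bs)) else 0)

-- q_v : index of the rightmost leaf of the subtree rooted at l(v)
q : ℕ → Node → ℕ
q n v = lo n v + 2 ^ (n ∸ suc (depth v))

InSubtree : ℕ → ℕ → Node → Set
InSubtree n x v = lo n v < x × x ≤ lo n v + 2 ^ (n ∸ depth v)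

-- the true answer to the main query of v ("is x ≤ q_v ?"; true = Yes)
truth : ℕ → ℕ → Node → Bool
truth n x v = x ≤ᵇ q n v

-- child of v to which a Move-down goes, given main(v):
-- Yes (true) → l(v), No (false) → r(v)
child : Bool → Node → Node
child a v = not a ∷ v

-- A query is identified by the node whose main query is asked.
-- History: chronological list of (queried node, answer).
History : Set
History = List (Node × Bool)

Oracle : Set
Oracle = History → Node → Bool

data Move : Set where
  moveDown moveUp noMove : Move

record Iter : Set where
  constructor iter
  field
    node    : Node
    mainAns : Bool
    check   : Maybe (Node × Bool)  -- just (anc(v) , check(v)) if a checkup was asked
    move    : Move
open Iter public

record State : Set where
  constructor state
  field
    cur   : Node
    mu    : ℕ
    store : Node → Maybe Bool      -- currently stored main(w)
    hist  : History
open State public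

bEq : Bool → Bool → Bool
bEq true true = true
bEq false false = true
bEq _ _ = false

differs : Maybe Bool → Bool → Bool
differs (just b) a = not (bEq a b)
differs nothing a = false

ancOf : (Node → Maybe Bool) → Bool → Node → Maybe Node
ancOf st a [] = nothing
ancOf st a (_ ∷ p) = go p
  where
  go : Node → Maybe Node
  go [] = if differs (st []) a then just [] else nothing
  go (b ∷ w) = if differs (st (b ∷ w)) a then just (b ∷ w) else go w

update : (Node → Maybe Bool) → Node → Bool → (Node → Maybe Bool)
update st v a w with w ≟ₙ v
... | yes _ = just a
... | no  _ = st w

parent : Node → Node
parent [] = []
parent (_ ∷ p) = p

-- Run RBIS with k remaining queries from state s, returning the list of
-- iterations performed and the final state.
run : Oracle → ℕ → State → List Iter × State
run O zero s = [] , s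
run O (suc k) (state v m st h) with O h v
... | a with ancOf (update st v a) a v
...   | nothing =
          let (its , fin) = run O k (state (child a v) m (update st v a) (h ++ ((v , a) ∷ [])))
          in iter v a nothing moveDown ∷ its , fin
...   | just w with k
...     | zero = iter v a nothing noMove ∷ [] ,
                 state v m (update st v a) (h ++ ((v , a) ∷ []))
...     | suc k' with O (h ++ ((v , a) ∷ [])) w
...       | c with update st v a w
...         | sw with differs sw c
...           | false =
                let (its , fin) = run O k' (state (child a v) m (update st v a)
                                             (h ++ ((v , a) ∷ (w , c) ∷ [])))
                in iter v a (just (w , c)) moveDown ∷ its , fin
...           | true =
                let (its , fin) = run O k' (state (parent v) (suc m) (update st v a)
                                             (h ++ ((v , a) ∷ (w , c) ∷ [])))
                in iter v a (just (w , c)) moveUp ∷ its , fin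

initial : State
initial = state [] 0 (λ _ → nothing) []

rbis : Oracle → ℕ → List Iter × State
rbis O n = run O n initial

incorrect : ℕ → ℕ → History → ℕ
incorrect n x [] = 0
incorrect n x ((w , a) ∷ h) = (if bEq a (truth n x w) then 0 else 1) + incorrect n x h

-- If main(v) is correct and L_x lies outside the subtree of v, then L_x lies on
-- the side of that subtree named by main(v). Climbing from v, the ancestors
-- passed on that same side have stored answers equal to main(v), and the first
-- one where the path turns has stored answer ≠ main(v) while its true answer is
-- main(v); the root cannot be passed, as L_x lies inside the whole tree. So
-- anc(v) exists and its stored answer is wrong; a Move-down then needs
-- check(v) = main(anc(v)), which makes check(v) wrong.
module Submission where

open import Defs
open import Data.Nat using (ℕ; _≤_; _^_)
open import Data.Bool using (Bool)
open import Data.List using (List)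
open import Data.List.Membership.Propositional using (_∈_)
open import Data.Maybe using (just)
open import Data.Product using (_×_; _,_; proj₁; proj₂; ∃₂)
open import Data.Sum using (_⊎_)
open import Relation.Binary.PropositionalEquality using (_≡_; _≢_)

open import Data.Nat using (zero; suc; _+_; _∸_; _<_; s≤s)
open import Data.Nat.Properties
open import Data.Bool using (true; false; not; if_then_else_)
open import Data.Bool.Properties using (not-involutive; not-¬) renaming (_≟_ to _≟ᴮ_)
open import Data.List using ([]; _∷_; length; _++_)
open import Data.List.Relation.Unary.Any using (here; there)
open import Data.Maybe using (Maybe; nothing)
open import Data.Product using (∃)
open import Data.Sum using (inj₁; inj₂)
open import Data.Unit using (⊤; tt)
open import Data.Empty using (⊥; ⊥-elim)
open import Relation.Nullary using (yes; no)
open import Function using (id)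
open import Relation.Nullary.Reflects using (Reflects; ofʸ; ofⁿ)
open import Relation.Binary.PropositionalEquality using (refl; sym; trans; cong; subst; module ≡-Reasoning)
open ≡-Reasoning

2^[n∸d]≡2^[n∸1+d]+2^[n∸1+d] : ∀ n d → d < n → 2 ^ (n ∸ d) ≡ 2 ^ (n ∸ suc d) + 2 ^ (n ∸ suc d)
2^[n∸d]≡2^[n∸1+d]+2^[n∸1+d] (suc n) zero    _       = cong (2 ^ n +_) (+-identityʳ (2 ^ n))
2^[n∸d]≡2^[n∸1+d]+2^[n∸1+d] (suc n) (suc d) (s≤s d<n) = 2^[n∸d]≡2^[n∸1+d]+2^[n∸1+d] n d d<n

ancOf-∷ : ∀ st a b p → ancOf st a (b ∷ p) ≡ (if differs (st p) a then just p else ancOf st a p)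
ancOf-∷ st a b []      = refl
ancOf-∷ st a b (c ∷ p) = refl

budget-child : ∀ {d k n} → d + suc k ≤ n → suc d + k ≤ n
budget-child {d} {k} {n} = subst (_≤ n) (+-suc d k)

budget-drop : ∀ {d k n} → d + suc k ≤ n → d + k ≤ n
budget-drop {d} {k} = ≤-trans (+-monoʳ-≤ d (n≤1+n k))

budget-parent : ∀ {k n} v → depth v + k ≤ n → depth (parent v) + k ≤ n
budget-parent []      = id
budget-parent (b ∷ p) = ≤-trans (n≤1+n _)

differs-just-false : ∀ b c → differs (just b) c ≡ false → c ≡ b
differs-just-false true  true  _ = refl
differs-just-false false false _ = refl

update-self : ∀ st v (a : Bool) → update st v a v ≡ just a
update-self st v a with v ≟ₙ v
... | yes _  = refl
... | no v≢v = ⊥-elim (v≢v refl)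

update-shallower : ∀ st v (a : Bool) w → length w < length v → update st v a w ≡ st w
update-shallower st v a w w<v with w ≟ₙ v
... | yes refl = ⊥-elim (<-irrefl refl w<v)
... | no _     = refl

-- Every proper ancestor of v stores the answer that leads from it towards v.
OnStoredPath : (Node → Maybe Bool) → Node → Set
OnStoredPath st []      = ⊤
OnStoredPath st (b ∷ p) = st p ≡ just (not b) × OnStoredPath st p

onStoredPath-update : ∀ st u (a : Bool) v → length v ≤ length u →
                      OnStoredPath st v → OnStoredPath (update st u a) v
onStoredPath-update st u a []      v≤u tt           = tt
onStoredPath-update st u a (b ∷ p) v≤u (stored , path) =
  trans (update-shallower st u a p v≤u) stored ,
  onStoredPath-update st u a p (<⇒≤ v≤u) path

onStoredPath-child : ∀ st v a → OnStoredPath st v → OnStoredPath (update st v a) (child a v)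
onStoredPath-child st v a path =
  trans (update-self st v a) (cong just (sym (not-involutive a))) ,
  onStoredPath-update st v a v ≤-refl path

onStoredPath-parent : ∀ st v a → OnStoredPath st v → OnStoredPath (update st v a) (parent v)
onStoredPath-parent st []      a _          = tt
onStoredPath-parent st (b ∷ p) a (_ , path) = onStoredPath-update st (b ∷ p) a p (n≤1+n _) path

module _ (n x : ℕ) where

  hi : Node → ℕ
  hi v = lo n v + 2 ^ (n ∸ depth v)

  lo-left : ∀ v → lo n (false ∷ v) ≡ lo n v
  lo-left v = +-identityʳ (lo n v)

  hi-right : ∀ v → depth v < n → hi (true ∷ v) ≡ hi v
  hi-right v d<n = begin
    lo n v + h + h   ≡⟨ +-assoc (lo n v) h h ⟩
    lo n v + (h + h) ≡⟨ cong (lo n v +_) (sym (2^[n∸d]≡2^[n∸1+d]+2^[n∸1+d] n (depth v) d<n)) ⟩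
    hi v             ∎
    where h = 2 ^ (n ∸ suc (depth v))

  truth-reflects : ∀ v → Reflects (x ≤ q n v) (truth n x v)
  truth-reflects v = ≤ᵇ-reflects-≤ x (q n v)

  truth-yes : ∀ v → x ≤ q n v → truth n x v ≡ true
  truth-yes v x≤q with truth n x v | truth-reflects v
  ... | true  | _        = refl
  ... | false | ofⁿ x≰q = ⊥-elim (x≰q x≤q)

  truth-no : ∀ v → q n v < x → truth n x v ≡ false
  truth-no v q<x with truth n x v | truth-reflects v
  ... | true  | ofʸ x≤q = ⊥-elim (<⇒≱ q<x x≤q)
  ... | false | _        = refl

  -- Outside true v: L_x is to the left of the subtree of v; Outside false v: to its right.
  Outside : Bool → Node → Set
  Outside true  v = x ≤ lo n v
  Outside false v = hi v < x

  child-of-truth-or-outside : ∀ v → depth v < n →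
    InSubtree n x (child (truth n x v) v) ⊎ Outside (truth n x v) v
  child-of-truth-or-outside v d<n with truth n x v | truth-reflects v
  ... | true | ofʸ x≤q with lo n v <? x
  ...   | yes lo<x = inj₁ (subst (_< x) (sym (lo-left v)) lo<x ,
                           subst (λ l → x ≤ l + 2 ^ (n ∸ suc (depth v))) (sym (lo-left v)) x≤q)
  ...   | no  lo≮x = inj₂ (≮⇒≥ lo≮x)
  child-of-truth-or-outside v d<n | false | ofⁿ x≰q with x ≤? hi v
  ...   | yes x≤hi = inj₁ (≰⇒> x≰q , subst (x ≤_) (sym (hi-right v d<n)) x≤hi)
  ...   | no  x≰hi = inj₂ (≰⇒> x≰hi)

  outside-toward : ∀ a p → Outside a (a ∷ p) → truth n x p ≡ a
  outside-toward true  p x≤q  = truth-yes p x≤q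
  outside-toward false p hi<x = truth-no p (subst (λ l → l + 2 ^ (n ∸ suc (depth p)) < x) (lo-left p) hi<x)

  outside-away : ∀ a p → depth p < n → Outside a (not a ∷ p) → Outside a p
  outside-away true  p d<n x≤lo = subst (x ≤_) (lo-left p) x≤lo
  outside-away false p d<n hi<x = subst (_< x) (hi-right p d<n) hi<x

  module _ (1≤x : 1 ≤ x) (x≤2ⁿ : x ≤ 2 ^ n) where

    ¬outside-root : ∀ a → Outside a [] → ⊥
    ¬outside-root true  x≤0  = <⇒≱ 1≤x x≤0
    ¬outside-root false 2ⁿ<x = <⇒≱ 2ⁿ<x x≤2ⁿ

    disagreeing-ancestor : ∀ st a v → depth v ≤ n → OnStoredPath st v → Outside a v →
      ∃ λ w → ancOf st a v ≡ just w × truth n x w ≡ a × st w ≡ just (not a)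
    disagreeing-ancestor st a [] _ _ out = ⊥-elim (¬outside-root a out)
    disagreeing-ancestor st true (true ∷ p) _ (stored , _) out
      rewrite ancOf-∷ st true true p | stored = p , refl , outside-toward true p out , stored
    disagreeing-ancestor st false (false ∷ p) _ (stored , _) out
      rewrite ancOf-∷ st false false p | stored = p , refl , outside-toward false p out , stored
    disagreeing-ancestor st true (false ∷ p) d≤n (stored , path) out
      rewrite ancOf-∷ st true false p | stored =
        disagreeing-ancestor st true p (<⇒≤ d≤n) path (outside-away true p d≤n out)
    disagreeing-ancestor st false (true ∷ p) d≤n (stored , path) out
      rewrite ancOf-∷ st false true p | stored =
        disagreeing-ancestor st false p (<⇒≤ d≤n) path (outside-away false p d≤n out)

    correct-child-or-disagreeing-ancestor : ∀ st v → depth v < n → OnStoredPath st v →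
      InSubtree n x (child (truth n x v) v)
      ⊎ ∃ λ w → ancOf st (truth n x v) v ≡ just w × truth n x w ≡ truth n x v
                × st w ≡ just (not (truth n x v))
    correct-child-or-disagreeing-ancestor st v d<n path with child-of-truth-or-outside v d<n
    ... | inj₁ inside = inj₁ inside
    ... | inj₂ out    = inj₂ (disagreeing-ancestor st _ v (<⇒≤ d<n) path out)

    SoundDescent : Iter → Set
    SoundDescent it = InSubtree n x (child (mainAns it) (node it))
      ⊎ (mainAns it ≢ truth n x (node it)
      ⊎ ∃₂ λ w c → check it ≡ just (w , c) × c ≢ truth n x w)

    unchecked-descent-sound : ∀ st v a → depth v < n → OnStoredPath st v → ancOf st a v ≡ nothing →
      SoundDescent (iter v a nothing moveDown)
    unchecked-descent-sound st v a d<n path no-anc with a ≟ᴮ truth n x v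
    ... | no  wrong = inj₂ (inj₁ wrong)
    ... | yes refl with correct-child-or-disagreeing-ancestor st v d<n path
    ...   | inj₁ inside = inj₁ inside
    ...   | inj₂ (w , anc , _) with trans (sym no-anc) anc
    ...     | ()

    checked-descent-sound : ∀ st v a w c → depth v < n → OnStoredPath st v →
      ancOf st a v ≡ just w → differs (st w) c ≡ false →
      SoundDescent (iter v a (just (w , c)) moveDown)
    checked-descent-sound st v a w c d<n path anc agree with a ≟ᴮ truth n x v
    ... | no  wrong = inj₂ (inj₁ wrong)
    ... | yes refl with correct-child-or-disagreeing-ancestor st v d<n path
    ...   | inj₁ inside = inj₁ inside
    ...   | inj₂ (w′ , anc′ , truth-w′ , stored-w′) with trans (sym anc) anc′
    ...     | refl = inj₂ (inj₂ (w , c , refl , c≢truth))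
      where
      c≡not-a : c ≡ not a
      c≡not-a = differs-just-false (not a) c (subst (λ s → differs s c ≡ false) stored-w′ agree)
      c≢truth : c ≢ truth n x w
      c≢truth c≡truth = not-¬ refl (sym (trans (sym c≡not-a) (trans c≡truth truth-w′)))

    -- Every iteration asks at least one query, so the budget depth (cur s) + k ≤ n keeps the current node above the leaf level.
    run-descents-sound : (O : Oracle) → ∀ k s → depth (cur s) + k ≤ n → OnStoredPath (store s) (cur s) →
      ∀ it → it ∈ proj₁ (run O k s) → move it ≡ moveDown → SoundDescent it
    run-descents-sound O zero s _ _ it () _
    run-descents-sound O (suc k) (state v m st h) budget path it mem down with O h v
    ... | a with ancOf (update st v a) a v in anc
    ...   | nothing with mem
    ...     | here refl = unchecked-descent-sound _ v a (m+n≤o⇒m≤o _ (budget-child budget))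
                            (onStoredPath-update st v a v ≤-refl path) anc
    ...     | there mem′ = run-descents-sound O k _ (budget-child budget)
                             (onStoredPath-child st v a path) it mem′ down
    run-descents-sound O (suc k) (state v m st h) budget path it mem down | a | just w with k
    ...     | zero with mem
    ...       | here refl with down
    ...         | ()
    run-descents-sound O (suc k) (state v m st h) budget path it mem down | a | just w | zero | there ()
    run-descents-sound O (suc k) (state v m st h) budget path it mem down | a | just w | suc k′
      with O (h ++ ((v , a) ∷ [])) w
    ...       | c with update st v a w in stored-w
    ...         | sw with differs sw c in agree
    ...           | false with mem
    ...             | here refl = checked-descent-sound _ v a w c (m+n≤o⇒m≤o _ (budget-child budget))
                                    (onStoredPath-update st v a v ≤-refl path) anc
                                    (trans (cong (λ s → differs s c) stored-w) agree)
    ...             | there mem′ = run-descents-sound O k′ _ (budget-drop {suc (depth v)} (budget-child budget))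
                                     (onStoredPath-child st v a path) it mem′ down
    run-descents-sound O (suc k) (state v m st h) budget path it mem down | a | just w | suc k′ | c | sw | true
      with mem
    ...             | here refl with down
    ...               | ()
    run-descents-sound O (suc k) (state v m st h) budget path it mem down | a | just w | suc k′ | c | sw | true
      | there mem′ = run-descents-sound O k′ _ (budget-parent v (budget-drop (budget-drop budget)))
                                     (onStoredPath-parent st v a path) it mem′ down

lemma1 : (n H x : ℕ) → 1 ≤ n → 1 ≤ x → x ≤ 2 ^ n → (O : Oracle) →
         incorrect n x (hist (proj₂ (rbis O n))) ≤ H →
         (it : Iter) → it ∈ proj₁ (rbis O n) → move it ≡ moveDown →
         InSubtree n x (child (mainAns it) (node it))
         ⊎ (mainAns it ≢ truth n x (node it)
            ⊎ ∃₂ λ w c → check it ≡ just (w , c) × c ≢ truth n x w)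
lemma1 n H x _ 1≤x x≤2ⁿ O _ = run-descents-sound n x 1≤x x≤2ⁿ O n initial ≤-refl tt
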